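{- Let $G$ be a finite abelian group which is not simple. Then no nontrivial proper subgroup of $G$ is a perfect code of $G$ if and only if $G$ is isomorphic to the cyclic group $\mathbb{Z}_{2^m}$ for some $m\ge 2$.
   Context: For a group $G$ and an inverse-closed subset $S\subseteq G$ with $e\notin S$, the Cayley graph $\mathrm{Cay}(G,S)$ has vertex set $G$, with distinct $x,y$ adjacent iff $yx^{ -1}\in S$. A subset $C$ of the vertex set of a graph is a perfect code if it is independent and every vertex outside $C$ is adjacent to exactly one vertex of $C$. A subset $C$ of $G$ is a perfect code of $G$ if some Cayley graph $\mathrm{Cay}(G,S)$ admits $C$ as a perfect code. -}

module Defs where

open import Level using (0ℓ)
open import Algebra.Bundles using (AbelianGroup)
open import Data.Nat using (ℕ; _+_; _^_; _≤_; NonZero)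
open import Data.Nat.Properties using (m^n≢0)
open import Data.Nat.DivMod using (_mod_)
open import Data.Fin using (Fin; toℕ)
open import Data.Bool using (Bool; true)
open import Data.Product using (Σ; ∃; _×_)
open import Relation.Nullary using (¬_)
open import Relation.Binary.PropositionalEquality using (_≡_)
import Relation.Binary.PropositionalEquality as ≡
open import Function.Bundles using (Inverse)

module _ (G : AbelianGroup 0ℓ 0ℓ) where
  open AbelianGroup G

  IsFinite : Set
  IsFinite = Σ ℕ λ n → Inverse setoid (≡.setoid (Fin n))

  record Subset : Set where
    field
      mem     : Carrier → Bool
      mem-resp : ∀ {x y} → x ≈ y → mem x ≡ mem y

  _∈_ : Carrier → Subset → Set
  x ∈ A = Subset.mem A x ≡ true

  _∉_ : Carrier → Subset → Set
  x ∉ A = ¬ (x ∈ A)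

  IsSubgroup : Subset → Set
  IsSubgroup H = (ε ∈ H)
               × (∀ x y → x ∈ H → y ∈ H → (x ∙ y) ∈ H)
               × (∀ x → x ∈ H → (x ⁻¹) ∈ H)

  IsNormal : Subset → Set
  IsNormal H = ∀ g h → h ∈ H → ((g ∙ h) ∙ (g ⁻¹)) ∈ H

  Nontrivial : Subset → Set
  Nontrivial H = ∃ λ h → h ∈ H × ¬ (h ≈ ε)

  Proper : Subset → Set
  Proper H = ∃ λ g → g ∉ H

  NotSimple : Set
  NotSimple = ∃ λ H → IsSubgroup H × IsNormal H × Nontrivial H × Proper H

  IsConnectionSet : Subset → Set
  IsConnectionSet S = (∀ x → x ∈ S → (x ⁻¹) ∈ S) × (ε ∉ S)

  Adj : Subset → Carrier → Carrier → Set
  Adj S x y = ¬ (x ≈ y) × ((y ∙ (x ⁻¹)) ∈ S)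

  IsPerfectCodeIn : Subset → Subset → Set
  IsPerfectCodeIn S C =
      (∀ x y → x ∈ C → y ∈ C → ¬ Adj S x y)
    × (∀ v → v ∉ C → ∃ λ c → c ∈ C × Adj S v c
                             × (∀ c′ → c′ ∈ C → Adj S v c′ → c′ ≈ c))

  IsPerfectCodeOf : Subset → Set
  IsPerfectCodeOf C = ∃ λ S → IsConnectionSet S × IsPerfectCodeIn S C

addMod : (k : ℕ) .{{_ : NonZero k}} → Fin k → Fin k → Fin k
addMod k a b = (toℕ a + toℕ b) mod k

IsoToZ : (G : AbelianGroup 0ℓ 0ℓ) (k : ℕ) .{{_ : NonZero k}} → Set
IsoToZ G k = Σ (Inverse (≡.setoid (Fin k)) setoid) λ φ →
               ∀ a b → Inverse.to φ (addMod k a b) ≈ (Inverse.to φ a ∙ Inverse.to φ b)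
  where open AbelianGroup G

IsCyclic2Power : AbelianGroup 0ℓ 0ℓ → Set
IsCyclic2Power G = ∃ λ m → 2 ≤ m × IsoToZ G (2 ^ m) {{m^n≢0 2 m}}

-- A subgroup H of an abelian group G is a perfect code iff every coset gH with g² ∈ H contains an
-- element of order at most 2. Necessity: if c ∈ H is the neighbour of g ∉ H in Cay(G,S), then so is
-- g²c⁻¹, because S is inverse-closed; hence c² = g² and gc⁻¹ has order at most 2. Sufficiency: an
-- inverse-closed set of coset representatives, found by searching an enumeration of G, is a
-- connection set for which H is a perfect code.
--
-- In Z_{2^m} every nontrivial subgroup contains the unique involution, while a proper subgroup H has
-- some x ∉ H with x² ∈ H, so xH contains no element of order at most 2. Conversely, suppose no
-- nontrivial proper subgroup is a perfect code. The elements of odd order form a subgroup meeting the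
-- criterion, so it is trivial (were it G, the nontrivial proper subgroup witnessing that G is not
-- simple would be a perfect code), and G is a 2-group. An element a of maximal order 2^m generates a
-- subgroup meeting the criterion, which must therefore be G; and m ≥ 2 since Z_2 is simple.

module Submission where

open import Defs hiding (_∈_; _∉_)
import Defs
open import Level using (0ℓ)
open import Algebra.Bundles using (AbelianGroup; Group)
open import Relation.Nullary using (¬_)
open import Function.Bundles using (_⇔_; mk⇔; Inverse)
open import Data.Bool using (Bool; true; false; if_then_else_)
import Data.Bool.Properties as Bool
open import Data.Empty using (⊥-elim)
open import Data.Fin using (Fin; zero; suc; toℕ)
import Data.Fin.Properties as Fin
open import Data.Maybe using (Maybe; just; nothing; fromMaybe)
import Data.Maybe as Maybe
open import Data.Nat as ℕ using (ℕ; zero; suc; _+_; _*_; _^_; _∸_; _<_; _≤_; _%_; _/_; _!; NonZero; z<s; s≤s; ≢-nonZero⁻¹)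
open import Data.Nat.DivMod using (_mod_; m%n<n; m≡m%n+[m/n]*n; m<n⇒m%n≡m; n%n≡0; %-distribˡ-+)
open import Data.Nat.Divisibility using (_∣_; divides; ∣-trans; m∣m*n; m≤n⇒m!∣n!; m%n≡0⇒n∣m; *-cancelˡ-∣)
open import Data.Nat.Induction using (<-rec)
open import Data.Nat.Tactic.RingSolver using (solve-∀)
import Data.Nat.Properties as ℕ
open import Data.Product using (∃; ∃₂; _×_; _,_; proj₁; proj₂; uncurry)
open import Data.Sum using (_⊎_; inj₁; inj₂)
import Data.Sum
open import Function using (_∘_; id)
open import Relation.Binary.Definitions using (Decidable)
open import Relation.Binary.PropositionalEquality as ≡ using (_≡_; _≗_)
open import Relation.Nullary using (Dec; yes; no; does)
open import Relation.Nullary.Decidable using (dec-true; does-⇔; map′; ¬?; _×-dec_; _⊎-dec_; _→-dec_)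

does⇒ : ∀ {A : Set} (a? : Dec A) → does a? ≡ true → A
does⇒ (yes a) _ = a

first : ∀ {k} → (Fin k → Bool) → Maybe (Fin k)
first {zero}  p = nothing
first {suc k} p = if p zero then just zero else Maybe.map suc (first (p ∘ suc))

first-cong : ∀ {k} {p q : Fin k → Bool} → p ≗ q → first p ≡ first q
first-cong {zero}  _ = ≡.refl
first-cong {suc k} {p} {q} p≗q rewrite p≗q zero | first-cong (p≗q ∘ suc) = ≡.refl

first-complete : ∀ {k} (p : Fin k → Bool) {i} → p i ≡ true →
                 ∃ λ j → first p ≡ just j × p j ≡ true
first-complete p {zero} pi rewrite pi = zero , ≡.refl , pi
first-complete p {suc i} pi with p zero in p0
... | true  = zero , ≡.refl , p0
... | false with first-complete (p ∘ suc) pi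
...   | j , eq , pj rewrite eq = suc j , ≡.refl , pj

parity : ∀ k → ∃ λ j → k ≡ 2 * j ⊎ k ≡ suc (2 * j)
parity zero = 0 , inj₁ ≡.refl
parity (suc k) with parity k
... | j , inj₁ ≡.refl = j , inj₂ ≡.refl
... | j , inj₂ ≡.refl = suc j , inj₁ (≡.cong suc (≡.sym (ℕ.+-suc j (j + 0))))

2-adic : ∀ k → .{{NonZero k}} → ∃₂ λ e r → k ≡ 2 ^ e * suc (2 * r)
2-adic = <-rec _ go
  where
  go : ∀ k → (∀ {j} → j < k → .{{NonZero j}} → ∃₂ λ e r → j ≡ 2 ^ e * suc (2 * r)) →
       .{{NonZero k}} → ∃₂ λ e r → k ≡ 2 ^ e * suc (2 * r)
  go k rec with parity k
  ... | r , inj₂ k≡odd = 0 , r , ≡.trans k≡odd (≡.sym (ℕ.+-identityʳ _))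
  ... | zero , inj₁ ≡.refl = ⊥-elim (≢-nonZero⁻¹ 0 ≡.refl)
  ... | suc j , inj₁ ≡.refl with rec (ℕ.m<m+n (suc j) z<s)
  ...   | e , r , eq = suc e , r , ≡.trans (≡.cong (2 *_) eq) (≡.sym (ℕ.*-assoc 2 (2 ^ e) _))

2^[m∸e]*2^e≡2^m : ∀ {m e} → e ≤ m → 2 ^ (m ∸ e) * 2 ^ e ≡ 2 ^ m
2^[m∸e]*2^e≡2^m {m} {e} e≤m = ≡.trans (≡.sym (ℕ.^-distribˡ-+-* 2 (m ∸ e) e)) (≡.cong (2 ^_) (ℕ.m∸n+n≡m e≤m))

*-odd : ∀ p r → p * suc (2 * r) ≡ p + r * (2 * p)
*-odd = solve-∀

2^[1+m]∣2r⇒r≡0⊎r≡2^m : ∀ m r → 2 ^ suc m ∣ 2 * r → r < 2 ^ suc m → r ≡ 0 ⊎ r ≡ 2 ^ m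
2^[1+m]∣2r⇒r≡0⊎r≡2^m m r N∣2r r<N with *-cancelˡ-∣ 2 N∣2r
... | divides zero          r≡0     = inj₁ r≡0
... | divides (suc zero)    r≡2^m   = inj₂ (≡.trans r≡2^m (ℕ.+-identityʳ (2 ^ m)))
... | divides (suc (suc q)) r≡[2+q]2^m =
  ⊥-elim (ℕ.<⇒≱ r<N (≡.subst (2 ^ suc m ≤_) (≡.sym r≡[2+q]2^m)
    (ℕ.+-monoʳ-≤ (2 ^ m) (ℕ.+-monoʳ-≤ (2 ^ m) ℕ.z≤n))))

module _ (G : AbelianGroup 0ℓ 0ℓ) where
  open AbelianGroup G
  open Group group using (_//_)
  open import Algebra.Properties.AbelianGroup G
  open import Algebra.Properties.CommutativeSemigroup commutativeSemigroup using (interchange; xy∙z≈xz∙y)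
  open import Algebra.Properties.CommutativeMonoid.Mult commutativeMonoid
    renaming (_×_ to _·_)
  open import Relation.Binary.Reasoning.Setoid setoid

  infix 4 _∈_ _∉_ _∈?_
  _∈_ : Carrier → Subset G → Set
  x ∈ A = Defs._∈_ G x A

  _∉_ : Carrier → Subset G → Set
  x ∉ A = Defs._∉_ G x A

  ∈-resp : ∀ A {x y} → x ≈ y → x ∈ A → y ∈ A
  ∈-resp A x≈y x∈A = ≡.trans (≡.sym (Subset.mem-resp A x≈y)) x∈A

  _∈?_ : ∀ x A → Dec (x ∈ A)
  x ∈? A = Subset.mem A x Bool.≟ true

  decSubset : (P : Carrier → Set) → (∀ x → Dec (P x)) → (∀ {x y} → x ≈ y → P x → P y) → Subset G
  decSubset P P? resp = record
    { mem      = does ∘ P?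
    ; mem-resp = λ x≈y → does-⇔ (mk⇔ (resp x≈y) (resp (sym x≈y))) (P? _) (P? _)
    }

  ·-ε : ∀ k → k · ε ≈ ε
  ·-ε zero    = refl
  ·-ε (suc k) = trans (identityˡ _) (·-ε k)

  ·-⁻¹ : ∀ k x → k · (x ⁻¹) ≈ (k · x) ⁻¹
  ·-⁻¹ zero    x = sym ε⁻¹≈ε
  ·-⁻¹ (suc k) x = trans (∙-congˡ (·-⁻¹ k x)) (⁻¹-∙-comm x (k · x))

  2·x≈x∙x : ∀ x → 2 · x ≈ x ∙ x
  2·x≈x∙x x = ∙-congˡ (identityʳ x)

  ∣-annihilates : ∀ {d j x} → d ∣ j → d · x ≈ ε → j · x ≈ ε
  ∣-annihilates {d} {x = x} (divides q ≡.refl) dx≈ε = begin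
    (q * d) · x  ≈⟨ ×-assocˡ x q d ⟨
    q · (d · x)  ≈⟨ ×-congʳ q dx≈ε ⟩
    q · ε        ≈⟨ ·-ε q ⟩
    ε            ∎

  ·≈ε-resp : ∀ k {x y} → x ≈ y → k · x ≈ ε → k · y ≈ ε
  ·≈ε-resp k x≈y kx≈ε = trans (×-congʳ k (sym x≈y)) kx≈ε

  //-∙-interchange : ∀ x y u v → (x ∙ u) // (y ∙ v) ≈ (x // y) ∙ (u // v)
  //-∙-interchange x y u v = begin
    (x ∙ u) ∙ (y ∙ v) ⁻¹       ≈⟨ ∙-congˡ (⁻¹-∙-comm y v) ⟨
    (x ∙ u) ∙ (y ⁻¹ ∙ v ⁻¹)    ≈⟨ interchange x u (y ⁻¹) (v ⁻¹) ⟩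
    (x // y) ∙ (u // v)        ∎

  InvolutionCondition : Subset G → Set
  InvolutionCondition H = ∀ g → g ∙ g ∈ H → ∃ λ h → h ∈ H × (g ∙ h) ∙ (g ∙ h) ≈ ε

  NoPerfectCodeSubgroup : Set
  NoPerfectCodeSubgroup = ∀ H → IsSubgroup G H → Nontrivial G H → Proper G H → ¬ IsPerfectCodeOf G H

  module Subgroup (H : Subset G) (H-sub : IsSubgroup G H) where

    ε∈ : ε ∈ H
    ε∈ = proj₁ H-sub

    ∙∈ : ∀ {x y} → x ∈ H → y ∈ H → x ∙ y ∈ H
    ∙∈ = proj₁ (proj₂ H-sub) _ _

    ⁻¹∈ : ∀ {x} → x ∈ H → x ⁻¹ ∈ H
    ⁻¹∈ = proj₂ (proj₂ H-sub) _

    ·∈ : ∀ k {x} → x ∈ H → k · x ∈ H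
    ·∈ zero    x∈H = ε∈
    ·∈ (suc k) x∈H = ∙∈ x∈H (·∈ k x∈H)

    ∉-⁻¹ : ∀ {x} → x ∉ H → x ⁻¹ ∉ H
    ∉-⁻¹ x∉H x⁻¹∈H = x∉H (∈-resp H (⁻¹-involutive _) (⁻¹∈ x⁻¹∈H))

    infix 4 _∼_ _∼?_
    _∼_ : Carrier → Carrier → Set
    x ∼ y = x // y ∈ H

    _∼?_ : ∀ x y → Dec (x ∼ y)
    x ∼? y = x // y ∈? H

    ∼-reflexive : ∀ {x y} → x ≈ y → x ∼ y
    ∼-reflexive x≈y = ∈-resp H (sym (x≈y⇒x∙y⁻¹≈ε x≈y)) ε∈

    ∼-sym : ∀ {x y} → x ∼ y → y ∼ x
    ∼-sym x∼y = ∈-resp H (⁻¹-anti-homo-// _ _) (⁻¹∈ x∼y)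

    ∼-∙ : ∀ {x y u v} → x ∼ y → u ∼ v → x ∙ u ∼ y ∙ v
    ∼-∙ x∼y u∼v = ∈-resp H (sym (//-∙-interchange _ _ _ _)) (∙∈ x∼y u∼v)

    ∼-trans : ∀ {x y z} → x ∼ y → y ∼ z → x ∼ z
    ∼-trans {x} {y} {z} x∼y y∼z = ∈-resp H cancel-y (∼-∙ x∼y y∼z)
      where
      cancel-y : (x ∙ y) // (y ∙ z) ≈ x // z
      cancel-y = begin
        (x ∙ y) // (y ∙ z)       ≈⟨ //-cong₂ refl (comm y z) ⟩
        (x ∙ y) // (z ∙ y)       ≈⟨ //-∙-interchange x z y y ⟩
        (x // z) ∙ (y // y)      ≈⟨ ∙-congˡ (inverseʳ y) ⟩
        (x // z) ∙ ε             ≈⟨ identityʳ _ ⟩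
        x // z                   ∎

    ∼-⁻¹ : ∀ {x y} → x ∼ y → x ⁻¹ ∼ y ⁻¹
    ∼-⁻¹ x∼y = ∈-resp H (sym (⁻¹-∙-comm _ _)) (⁻¹∈ x∼y)

    ∼-∈ : ∀ {x y} → x ∼ y → x ∈ H → y ∈ H
    ∼-∈ {x} {y} x∼y x∈H = ∈-resp H (//-rightDividesˡ x y) (∙∈ (∼-sym x∼y) x∈H)

    ∙∈-∼ : ∀ {h} x → h ∈ H → h ∙ x ∼ x
    ∙∈-∼ x h∈H = ∈-resp H (sym (//-rightDividesʳ x _)) h∈H

    adjacent : ∀ S {v c} → v ∉ H → c ∈ H → c // v ∈ S → Adj G S v c
    adjacent S v∉H c∈H c//v∈S = (λ v≈c → v∉H (∈-resp H (sym v≈c) c∈H)) , c//v∈S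

    squareRoot-outside : ∀ k {g} → g ∉ H → (2 ^ k) · g ∈ H → ∃ λ x → x ∉ H × x ∙ x ∈ H
    squareRoot-outside zero    g∉H 1·g∈H = ⊥-elim (g∉H (∈-resp H (identityʳ _) 1·g∈H))
    squareRoot-outside (suc k) {g} g∉H 2^[1+k]g∈H with (2 ^ k) · g ∈? H
    ... | yes 2^kg∈H = squareRoot-outside k g∉H 2^kg∈H
    ... | no 2^kg∉H  = (2 ^ k) · g , 2^kg∉H , ∈-resp H (begin
      (2 * 2 ^ k) · g              ≈⟨ ×-assocˡ g 2 (2 ^ k) ⟨
      2 · (2 ^ k) · g              ≈⟨ 2·x≈x∙x _ ⟩
      (2 ^ k) · g ∙ (2 ^ k) · g    ∎) 2^[1+k]g∈H

    perfectCode⇒involutionCondition : IsPerfectCodeOf G H → InvolutionCondition H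
    perfectCode⇒involutionCondition (S , (S-⁻¹ , _) , _ , cover) g g²∈H with g ∈? H
    ... | yes g∈H = g ⁻¹ , ⁻¹∈ g∈H , trans (∙-cong (inverseʳ g) (inverseʳ g)) (identityʳ ε)
    ... | no g∉H  = c ⁻¹ , ⁻¹∈ c∈H , (begin
          (g // c) ∙ (g // c)      ≈⟨ //-∙-interchange g c g c ⟨
          (g ∙ g) // (c ∙ c)       ≈⟨ //-cong₂ g²≈c² refl ⟩
          (c ∙ c) // (c ∙ c)       ≈⟨ inverseʳ _ ⟩
          ε                        ∎)
      where
      c = proj₁ (cover g g∉H)
      c∈H = proj₁ (proj₂ (cover g g∉H))
      c//g∈S = proj₂ (proj₁ (proj₂ (proj₂ (cover g g∉H))))
      unique = proj₂ (proj₂ (proj₂ (cover g g∉H)))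
      c′ = (g ∙ g) // c
      c′//g≈[c//g]⁻¹ : c′ // g ≈ (c // g) ⁻¹
      c′//g≈[c//g]⁻¹ = begin
        ((g ∙ g) // c) // g      ≈⟨ xy∙z≈xz∙y (g ∙ g) (c ⁻¹) (g ⁻¹) ⟩
        ((g ∙ g) // g) // c      ≈⟨ ∙-congʳ (//-rightDividesʳ g g) ⟩
        g // c                   ≈⟨ ⁻¹-anti-homo-// c g ⟨
        (c // g) ⁻¹              ∎
      g²≈c² : g ∙ g ≈ c ∙ c
      g²≈c² = trans (sym (//-rightDividesˡ c (g ∙ g))) (∙-congʳ c′≈c)
        where
        c′∈H = ∙∈ g²∈H (⁻¹∈ c∈H)
        c′≈c = unique c′ c′∈H (adjacent S g∉H c′∈H (∈-resp S (sym c′//g≈[c//g]⁻¹) (S-⁻¹ _ c//g∈S)))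

    perfectCode⇒involutionOutside : IsPerfectCodeOf G H → ∀ k → (∀ g → (2 ^ k) · g ≈ ε) → Proper G H →
                                    ∃ λ y → y ∉ H × y ∙ y ≈ ε
    perfectCode⇒involutionOutside H-perfect k exponent (g , g∉H)
      with squareRoot-outside k g∉H (∈-resp H (sym (exponent g)) ε∈)
    ... | x , x∉H , x²∈H with perfectCode⇒involutionCondition H-perfect x x²∈H
    ...   | h , h∈H , [xh]²≈ε = x ∙ h , xh∉H , [xh]²≈ε
      where xh∉H = λ xh∈H → x∉H (∈-resp H (//-rightDividesʳ h x) (∙∈ xh∈H (⁻¹∈ h∈H)))

    record SymmetricTransversal : Set where
      field
        rep      : Carrier → Carrier
        rep-∼    : ∀ x → rep x ∼ x
        rep-cong : ∀ {x y} → x ∼ y → rep x ≈ rep y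
        rep-⁻¹   : ∀ x → rep (x ⁻¹) ≈ rep x ⁻¹

    module _ (_≈?_ : Decidable _≈_) (T : SymmetricTransversal) where
      open SymmetricTransversal T

      IsRepresentative : Carrier → Set
      IsRepresentative s = s ∉ H × s ≈ rep s

      isRepresentative? : ∀ s → Dec (IsRepresentative s)
      isRepresentative? s = ¬? (s ∈? H) ×-dec (s ≈? rep s)

      representatives : Subset G
      representatives = decSubset IsRepresentative isRepresentative? resp
        where
        resp : ∀ {x y} → x ≈ y → IsRepresentative x → IsRepresentative y
        resp x≈y (x∉H , x≈rep) =
          (λ y∈H → x∉H (∈-resp H (sym x≈y) y∈H)) ,
          trans (sym x≈y) (trans x≈rep (rep-cong (∼-reflexive x≈y)))

      private
        S = representatives

        S⁺ : ∀ {s} → IsRepresentative s → s ∈ S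
        S⁺ = dec-true (isRepresentative? _)

        S⁻ : ∀ {s} → s ∈ S → IsRepresentative s
        S⁻ = does⇒ (isRepresentative? _)

      representatives-isConnectionSet : IsConnectionSet G S
      representatives-isConnectionSet = S-⁻¹ , λ ε∈S → proj₁ (S⁻ ε∈S) ε∈
        where
        S-⁻¹ : ∀ s → s ∈ S → s ⁻¹ ∈ S
        S-⁻¹ s s∈S with S⁻ s∈S
        ... | s∉H , s≈rep = S⁺ (∉-⁻¹ s∉H , trans (⁻¹-cong s≈rep) (sym (rep-⁻¹ s)))

      transversal-perfectCode : IsPerfectCodeIn G S H
      transversal-perfectCode = independent , covering
        where
        independent : ∀ x y → x ∈ H → y ∈ H → ¬ Adj G S x y
        independent x y x∈H y∈H (_ , y//x∈S) = proj₁ (S⁻ y//x∈S) (∙∈ y∈H (⁻¹∈ x∈H))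

        covering : ∀ v → v ∉ H → ∃ λ c → c ∈ H × Adj G S v c × (∀ c′ → c′ ∈ H → Adj G S v c′ → c′ ≈ c)
        covering v v∉H = c , c∈H , adjacent S v∉H c∈H c//v∈S , unique
          where
          s = rep (v ⁻¹)
          c = s ∙ v
          s∼v⁻¹ : s ∼ v ⁻¹
          s∼v⁻¹ = rep-∼ (v ⁻¹)
          c∈H : c ∈ H
          c∈H = ∈-resp H (∙-congˡ (⁻¹-involutive v)) s∼v⁻¹
          c//v≈s : c // v ≈ s
          c//v≈s = //-rightDividesʳ v s
          s∈S : s ∈ S
          s∈S = S⁺ ((λ s∈H → ∉-⁻¹ v∉H (∼-∈ s∼v⁻¹ s∈H)) , sym (rep-cong s∼v⁻¹))
          c//v∈S : c // v ∈ S
          c//v∈S = ∈-resp S (sym c//v≈s) s∈S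
          unique : ∀ c′ → c′ ∈ H → Adj G S v c′ → c′ ≈ c
          unique c′ c′∈H (_ , c′//v∈S) = ∙-cancelʳ (v ⁻¹) c′ c (begin
            c′ // v                ≈⟨ proj₂ (S⁻ c′//v∈S) ⟩
            rep (c′ // v)          ≈⟨ rep-cong (∙∈-∼ (v ⁻¹) c′∈H) ⟩
            s                      ≈⟨ c//v≈s ⟨
            c // v                 ∎)

      transversal⇒perfectCode : IsPerfectCodeOf G H
      transversal⇒perfectCode = S , representatives-isConnectionSet , transversal-perfectCode

  oddExponent⇒involutionCondition : ∀ H r → IsSubgroup G H → (∀ h → h ∈ H → suc (2 * r) · h ≈ ε) →
                                    InvolutionCondition H
  oddExponent⇒involutionCondition H r H-sub odd g g²∈H = h , ·∈ r g²∈H , (begin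
    (g ∙ h) ∙ (g ∙ h)            ≈⟨ interchange g h g h ⟩
    (g ∙ g) ∙ (h ∙ h)            ≈⟨ ∙-congˡ (×-homo-+ (g ∙ g) r r) ⟨
    (g ∙ g) ∙ (r + r) · (g ∙ g)  ≈⟨ ∙-congˡ (reflexive (≡.cong (_· (g ∙ g)) (≡.cong (r +_) (ℕ.+-identityʳ r)))) ⟨
    suc (2 * r) · (g ∙ g)        ≈⟨ odd (g ∙ g) g²∈H ⟩
    ε                            ∎)
    where
    open Subgroup H H-sub
    h = r · (g ∙ g)

  2-group⇒noPerfectCodeSubgroup : ∀ k → (∀ g → (2 ^ k) · g ≈ ε) →
    (∀ H → IsSubgroup G H → Nontrivial G H → ∀ y → y ∙ y ≈ ε → y ∈ H) → NoPerfectCodeSubgroup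
  2-group⇒noPerfectCodeSubgroup k exponent involution∈ H H-sub H-nontrivial H-proper H-perfect
    with Subgroup.perfectCode⇒involutionOutside H H-sub H-perfect k exponent H-proper
  ... | y , y∉H , y²≈ε = y∉H (involution∈ H H-sub H-nontrivial y y²≈ε)

  module CyclicTwoPower (m : ℕ) (a : Carrier)
                        (2^[1+m]a≈ε : (2 ^ suc m) · a ≈ ε) (2^ma≉ε : ¬ (2 ^ m) · a ≈ ε) where

    N : ℕ
    N = 2 ^ suc m

    instance
      N≢0 : NonZero N
      N≢0 = ℕ.m^n≢0 2 (suc m)

    t : Carrier
    t = (2 ^ m) · a

    *N·a≈ε : ∀ q → (q * N) · a ≈ ε
    *N·a≈ε q = ∣-annihilates (divides q ≡.refl) 2^[1+m]a≈ε

    ·-mod : ∀ j → j · a ≈ (j % N) · a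
    ·-mod j = begin
      j · a                            ≈⟨ reflexive (≡.cong (_· a) (m≡m%n+[m/n]*n j N)) ⟩
      (j % N + (j / N) * N) · a        ≈⟨ ×-homo-+ a (j % N) _ ⟩
      (j % N) · a ∙ ((j / N) * N) · a  ≈⟨ ∙-congˡ (*N·a≈ε (j / N)) ⟩
      (j % N) · a ∙ ε                  ≈⟨ identityʳ _ ⟩
      (j % N) · a                      ∎

    -- writing j = 2^e u with u odd, c = 2^(m-e) gives c j = 2^m u ≡ 2^m modulo N
    ·-reaches-t : ∀ j → .{{NonZero j}} → j < N → ∃ λ c → c · (j · a) ≈ t
    ·-reaches-t j j<N with 2-adic j
    ... | e , r , j≡2^e*u = 2 ^ (m ∸ e) , (begin
      (2 ^ (m ∸ e)) · (j · a)  ≈⟨ ×-assocˡ a (2 ^ (m ∸ e)) j ⟩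
      (2 ^ (m ∸ e) * j) · a    ≈⟨ reflexive (≡.cong (_· a) c*j≡2^m+r*N) ⟩
      (2 ^ m + r * N) · a      ≈⟨ ×-homo-+ a (2 ^ m) (r * N) ⟩
      t ∙ (r * N) · a          ≈⟨ ∙-congˡ (*N·a≈ε r) ⟩
      t ∙ ε                    ≈⟨ identityʳ t ⟩
      t                        ∎)
      where
      u = suc (2 * r)
      e≤m : e ≤ m
      e≤m with e ℕ.≤? m
      ... | yes e≤m = e≤m
      ... | no e≰m  = ⊥-elim (ℕ.<⇒≱ j<N (ℕ.≤-trans (ℕ.^-monoʳ-≤ 2 (ℕ.≰⇒> e≰m))
                                        (ℕ.≤-trans (ℕ.m≤m*n (2 ^ e) u) (ℕ.≤-reflexive (≡.sym j≡2^e*u)))))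
      c*j≡2^m+r*N : 2 ^ (m ∸ e) * j ≡ 2 ^ m + r * N
      c*j≡2^m+r*N = ≡.trans (≡.cong (2 ^ (m ∸ e) *_) j≡2^e*u) (≡.trans (≡.sym (ℕ.*-assoc (2 ^ (m ∸ e)) (2 ^ e) u))
                      (≡.trans (≡.cong (_* u) (2^[m∸e]*2^e≡2^m e≤m)) (*-odd (2 ^ m) r)))

    ·≈ε⇒≡0 : ∀ j → j < N → j · a ≈ ε → j ≡ 0
    ·≈ε⇒≡0 zero    _   _    = ≡.refl
    ·≈ε⇒≡0 (suc j) j<N ja≈ε with ·-reaches-t (suc j) j<N
    ... | c , cja≈t = ⊥-elim (2^ma≉ε (trans (sym cja≈t) (trans (×-congʳ c ja≈ε) (·-ε c))))

    order-divides : ∀ j → j · a ≈ ε → N ∣ j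
    order-divides j ja≈ε = m%n≡0⇒n∣m j N (·≈ε⇒≡0 (j % N) (m%n<n j N) (trans (sym (·-mod j)) ja≈ε))

    ·-injective-≤ : ∀ {i j} → i ≤ j → j < N → i · a ≈ j · a → i ≡ j
    ·-injective-≤ {i} {j} i≤j j<N ia≈ja with ℕ.m≤n⇒∃[o]m+o≡n i≤j
    ... | d , i+d≡j = ≡.trans (≡.sym (ℕ.+-identityʳ i)) (≡.trans (≡.cong (i +_) (≡.sym d≡0)) i+d≡j)
      where
      d≡0 : d ≡ 0
      d≡0 = ·≈ε⇒≡0 d (ℕ.≤-<-trans (ℕ.≤-trans (ℕ.m≤n+m d i) (ℕ.≤-reflexive i+d≡j)) j<N)
              (identityʳ-unique (i · a) (d · a) (begin
                i · a ∙ d · a  ≈⟨ ×-homo-+ a i d ⟨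
                (i + d) · a    ≈⟨ reflexive (≡.cong (_· a) i+d≡j) ⟩
                j · a          ≈⟨ ia≈ja ⟨
                i · a          ∎))

    ·-injective : ∀ {i j} → i < N → j < N → i · a ≈ j · a → i ≡ j
    ·-injective {i} {j} i<N j<N ia≈ja with ℕ.≤-total i j
    ... | inj₁ i≤j = ·-injective-≤ i≤j j<N ia≈ja
    ... | inj₂ j≤i = ≡.sym (·-injective-≤ j≤i i<N (sym ia≈ja))

    involution-ε⊎t : ∀ j → j · a ∙ j · a ≈ ε → j · a ≈ ε ⊎ j · a ≈ t
    involution-ε⊎t j [ja]²≈ε
      with 2^[1+m]∣2r⇒r≡0⊎r≡2^m m (j % N) (order-divides (2 * (j % N)) 2[j%N]a≈ε) (m%n<n j N)
      where
      2[j%N]a≈ε : (2 * (j % N)) · a ≈ ε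
      2[j%N]a≈ε = begin
        (2 * (j % N)) · a            ≈⟨ ×-assocˡ a 2 (j % N) ⟨
        2 · (j % N) · a              ≈⟨ 2·x≈x∙x _ ⟩
        (j % N) · a ∙ (j % N) · a    ≈⟨ ∙-cong (·-mod j) (·-mod j) ⟨
        j · a ∙ j · a                ≈⟨ [ja]²≈ε ⟩
        ε                            ∎
    ... | inj₁ j%N≡0   = inj₁ (trans (·-mod j) (reflexive (≡.cong (_· a) j%N≡0)))
    ... | inj₂ j%N≡2^m = inj₂ (trans (·-mod j) (reflexive (≡.cong (_· a) j%N≡2^m)))

    module _ (generated : ∀ g → ∃ λ j → g ≈ j · a) where

      N·g≈ε : ∀ g → N · g ≈ ε
      N·g≈ε g = trans (×-congʳ N (proj₂ (generated g))) (trans (×-assocˡ a N j)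
                     (trans (reflexive (≡.cong (_· a) (ℕ.*-comm N j))) (*N·a≈ε j)))
        where j = proj₁ (generated g)

      t∈nontrivial : ∀ H → IsSubgroup G H → Nontrivial G H → t ∈ H
      t∈nontrivial H H-sub (h , h∈H , h≉ε) = reach (j % N) (m%n<n j N) (trans h≈ja (·-mod j))
        where
        open Subgroup H H-sub
        j = proj₁ (generated h)
        h≈ja = proj₂ (generated h)
        reach : ∀ r → r < N → h ≈ r · a → t ∈ H
        reach zero    _   h≈ε  = ⊥-elim (h≉ε h≈ε)
        reach (suc r) r<N h≈ra with ·-reaches-t (suc r) r<N
        ... | c , c·ra≈t = ∈-resp H (trans (×-congʳ c h≈ra) c·ra≈t) (·∈ c h∈H)

      involution∈nontrivial : ∀ H → IsSubgroup G H → Nontrivial G H → ∀ y → y ∙ y ≈ ε → y ∈ H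
      involution∈nontrivial H H-sub H-nontrivial y y²≈ε with generated y
      ... | j , y≈ja with involution-ε⊎t j (trans (∙-cong (sym y≈ja) (sym y≈ja)) y²≈ε)
      ...   | inj₁ ja≈ε = ∈-resp H (sym (trans y≈ja ja≈ε)) (Subgroup.ε∈ H H-sub)
      ...   | inj₂ ja≈t = ∈-resp H (sym (trans y≈ja ja≈t)) (t∈nontrivial H H-sub H-nontrivial)

  module FromIsoToZ (k : ℕ) .{{_ : NonZero k}} (iso : IsoToZ G k) where

    private
      φ = proj₁ iso
      to = Inverse.to φ
      from = Inverse.from φ

      to-injective : ∀ {i j} → to i ≈ to j → i ≡ j
      to-injective {i} {j} p =
        ≡.trans (≡.sym (Inverse.strictlyInverseʳ φ i))
                (≡.trans (Inverse.from-cong φ p) (Inverse.strictlyInverseʳ φ j))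

    generator : Carrier
    generator = to (1 mod k)

    toℕ-mod : ∀ j → toℕ (j mod k) ≡ j % k
    toℕ-mod j = Fin.toℕ-fromℕ< (m%n<n j k)

    mod-cong : ∀ {i j} → i % k ≡ j % k → i mod k ≡ j mod k
    mod-cong {i} {j} eq = Fin.toℕ-injective (≡.trans (toℕ-mod i) (≡.trans eq (≡.sym (toℕ-mod j))))

    toℕ-mod-id : ∀ i → toℕ i mod k ≡ i
    toℕ-mod-id i = Fin.toℕ-injective (≡.trans (toℕ-mod (toℕ i)) (m<n⇒m%n≡m (Fin.toℕ<n i)))

    0%k≡0 : 0 % k ≡ 0
    0%k≡0 = m<n⇒m%n≡m (ℕ.>-nonZero⁻¹ k)

    addMod-mod : ∀ i j → addMod k (i mod k) (j mod k) ≡ (i + j) mod k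
    addMod-mod i j = mod-cong (≡.sym (≡.trans (%-distribˡ-+ i j k)
                       (≡.cong₂ (λ x y → (x + y) % k) (≡.sym (toℕ-mod i)) (≡.sym (toℕ-mod j)))))

    to-0 : to (0 mod k) ≈ ε
    to-0 = identityʳ-unique (to (0 mod k)) (to (0 mod k))
             (sym (trans (reflexive (≡.cong to (≡.sym (addMod-mod 0 0)))) (proj₂ iso (0 mod k) (0 mod k))))

    to-mod : ∀ j → to (j mod k) ≈ j · generator
    to-mod zero    = to-0
    to-mod (suc j) = begin
      to (suc j mod k)                        ≈⟨ reflexive (≡.cong to (≡.sym (addMod-mod 1 j))) ⟩
      to (addMod k (1 mod k) (j mod k))       ≈⟨ proj₂ iso (1 mod k) (j mod k) ⟩
      generator ∙ to (j mod k)                ≈⟨ ∙-congˡ (to-mod j) ⟩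
      generator ∙ j · generator               ∎

    generates : ∀ g → ∃ λ j → g ≈ j · generator
    generates g = toℕ (from g) , (begin
      g                          ≈⟨ Inverse.strictlyInverseˡ φ g ⟨
      to (from g)                ≈⟨ reflexive (≡.cong to (≡.sym (toℕ-mod-id (from g)))) ⟩
      to (toℕ (from g) mod k)    ≈⟨ to-mod (toℕ (from g)) ⟩
      toℕ (from g) · generator   ∎)

    k·generator≈ε : k · generator ≈ ε
    k·generator≈ε = begin
      k · generator  ≈⟨ to-mod k ⟨
      to (k mod k)   ≈⟨ reflexive (≡.cong to (mod-cong (≡.trans (n%n≡0 k) (≡.sym 0%k≡0)))) ⟩
      to (0 mod k)   ≈⟨ to-0 ⟩
      ε              ∎

    ·generator≈ε⇒≡0 : ∀ {j} → j < k → j · generator ≈ ε → j ≡ 0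
    ·generator≈ε⇒≡0 {j} j<k j·g≈ε = ≡.trans (≡.sym (m<n⇒m%n≡m j<k)) (≡.trans j%k≡0%k 0%k≡0)
      where
      j%k≡0%k : j % k ≡ 0 % k
      j%k≡0%k = ≡.trans (≡.sym (toℕ-mod j)) (≡.trans (≡.cong toℕ j-mod-k≡0-mod-k) (toℕ-mod 0))
        where
        j-mod-k≡0-mod-k : j mod k ≡ 0 mod k
        j-mod-k≡0-mod-k = to-injective (trans (to-mod j) (trans j·g≈ε (sym to-0)))

  cyclic2Power⇒noPerfectCodeSubgroup : IsCyclic2Power G → NoPerfectCodeSubgroup
  cyclic2Power⇒noPerfectCodeSubgroup (zero  , ()    , _)
  cyclic2Power⇒noPerfectCodeSubgroup (suc m , _ , iso) =
    2-group⇒noPerfectCodeSubgroup (suc m) (N·g≈ε generates) (involution∈nontrivial generates)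
    where
    open FromIsoToZ (2 ^ suc m) {{ℕ.m^n≢0 2 (suc m)}} iso
    2^m·generator≉ε : ¬ (2 ^ m) · generator ≈ ε
    2^m·generator≉ε 2^m·g≈ε = ≢-nonZero⁻¹ (2 ^ m) {{ℕ.m^n≢0 2 m}}
      (·generator≈ε⇒≡0 (ℕ.^-monoʳ-< 2 (ℕ.n<1+n 1) (ℕ.n<1+n m)) 2^m·g≈ε)
    open CyclicTwoPower m generator k·generator≈ε 2^m·generator≉ε

  atMostTwo⇒¬NotSimple : ∀ a → (∀ y → y ≈ ε ⊎ y ≈ a) → ¬ NotSimple G
  atMostTwo⇒¬NotSimple a ε-or-a (H , H-sub , _ , (h , h∈H , h≉ε) , (g , g∉H)) = g∉H (g∈H (ε-or-a g))
    where
    open Subgroup H H-sub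
    h≈a : h ≈ a
    h≈a = Data.Sum.[ (λ h≈ε → ⊥-elim (h≉ε h≈ε)) , (λ h≈a → h≈a) ] (ε-or-a h)
    g∈H : g ≈ ε ⊎ g ≈ a → g ∈ H
    g∈H (inj₁ g≈ε) = ∈-resp H (sym g≈ε) ε∈
    g∈H (inj₂ g≈a) = ∈-resp H (trans h≈a (sym g≈a)) h∈H

  module Finite (fin : IsFinite G) where

    n : ℕ
    n = proj₁ fin

    index : Carrier → Fin n
    index = Inverse.to (proj₂ fin)

    element : Fin n → Carrier
    element = Inverse.from (proj₂ fin)

    element-index : ∀ x → element (index x) ≈ x
    element-index = Inverse.strictlyInverseʳ (proj₂ fin)

    index-injective : ∀ {x y} → index x ≡ index y → x ≈ y
    index-injective {x} {y} eq =
      trans (sym (element-index x)) (trans (reflexive (≡.cong element eq)) (element-index y))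

    infix 4 _≈?_
    _≈?_ : Decidable _≈_
    x ≈? y = map′ index-injective (Inverse.to-cong (proj₂ fin)) (index x Fin.≟ index y)

    ∀⊎∃¬ : ∀ {P : Carrier → Set} → (∀ x → Dec (P x)) → (∀ {x y} → x ≈ y → P x → P y) →
           (∀ x → P x) ⊎ ∃ λ x → ¬ P x
    ∀⊎∃¬ {P} P? resp with Fin.all? (P? ∘ element)
    ... | yes all = inj₁ λ x → resp (element-index x) (all (index x))
    ... | no ¬all = inj₂ (element (proj₁ counterexample) , proj₂ counterexample)
      where counterexample = Fin.¬∀⟶∃¬ n (P ∘ element) (P? ∘ element) ¬all

    order : ∀ x → ∃ λ d → suc d ≤ n × suc d · x ≈ ε
    order x with Fin.pigeonhole (ℕ.n<1+n n) (λ (i : Fin (suc n)) → index (toℕ i · x))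
    ... | i , j , i<j , eq with ℕ.m≤n⇒∃[o]m+o≡n i<j
    ...   | k , i+1+k≡j = k , 1+k≤n , identityʳ-unique (toℕ i · x) (suc k · x) (begin
      toℕ i · x ∙ suc k · x    ≈⟨ ×-homo-+ x (toℕ i) (suc k) ⟨
      (toℕ i + suc k) · x      ≈⟨ reflexive (≡.cong (_· x) i+1+k≡j′) ⟩
      toℕ j · x                ≈⟨ index-injective eq ⟨
      toℕ i · x                ∎)
      where
      i+1+k≡j′ : toℕ i + suc k ≡ toℕ j
      i+1+k≡j′ = ≡.trans (ℕ.+-suc (toℕ i) k) i+1+k≡j
      1+k≤n : suc k ≤ n
      1+k≤n = ℕ.≤-trans (ℕ.≤-trans (ℕ.m≤n+m (suc k) (toℕ i)) (ℕ.≤-reflexive i+1+k≡j′)) (Fin.toℕ≤pred[n] j)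

    n!·x≈ε : ∀ x → (n !) · x ≈ ε
    n!·x≈ε x with order x
    ... | d , d<n , [1+d]x≈ε = ∣-annihilates (∣-trans (m∣m*n {suc d} (d !)) (m≤n⇒m!∣n! d<n)) [1+d]x≈ε

    module Transversal (H : Subset G) (H-sub : IsSubgroup G H) (condition : InvolutionCondition H) where
      open Subgroup H H-sub

      -- for y in xH or x⁻¹H, y ∙ y ∈ H means xH = x⁻¹H; such a coset needs a self-inverse representative
      Candidate : Carrier → Carrier → Set
      Candidate x y = (y ∼ x ⊎ y ∼ x ⁻¹) × (y ∙ y ∈ H → y ∙ y ≈ ε)

      candidate? : ∀ x y → Dec (Candidate x y)
      candidate? x y = (y ∼? x ⊎-dec y ∼? x ⁻¹) ×-dec (y ∙ y ∈? H →-dec y ∙ y ≈? ε)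

      candidate-exists : ∀ x → ∃ (Candidate x)
      candidate-exists x with x ∙ x ∈? H
      ... | no x²∉H = x , inj₁ (∼-reflexive refl) , λ x²∈H → ⊥-elim (x²∉H x²∈H)
      ... | yes x²∈H with condition x x²∈H
      ...   | h , h∈H , [xh]²≈ε = x ∙ h , inj₁ xh∼x , λ _ → [xh]²≈ε
        where xh∼x = ∼-trans (∼-reflexive (comm x h)) (∙∈-∼ x h∈H)

      Candidate-≈ : ∀ {x y y′} → y ≈ y′ → Candidate x y → Candidate x y′
      Candidate-≈ {y′ = y′} y≈y′ (y∼ , y²) = Data.Sum.map (∼-trans y′∼y) (∼-trans y′∼y) y∼ , y′²
        where
        y′∼y = ∼-reflexive (sym y≈y′)
        y′²≈y² = ∙-cong (sym y≈y′) (sym y≈y′)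
        y′² : y′ ∙ y′ ∈ H → y′ ∙ y′ ≈ ε
        y′² y′²∈H = trans y′²≈y² (y² (∈-resp H y′²≈y² y′²∈H))

      Candidate-resp : ∀ {x x′ y} → x ∼ x′ → Candidate x y → Candidate x′ y
      Candidate-resp x∼x′ (y∼ , y²) =
        Data.Sum.map (λ y∼x → ∼-trans y∼x x∼x′) (λ y∼x⁻¹ → ∼-trans y∼x⁻¹ (∼-⁻¹ x∼x′)) y∼ , y²

      Candidate-⁻¹ : ∀ {x y} → Candidate x y → Candidate (x ⁻¹) y
      Candidate-⁻¹ (y∼ , y²) = Data.Sum.[ (λ y∼x → inj₂ (∼-trans y∼x x∼x⁻¹⁻¹)) , inj₁ ] y∼ , y²
        where x∼x⁻¹⁻¹ = ∼-reflexive (sym (⁻¹-involutive _))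

      Candidate-⁻¹⁻ : ∀ {x y} → Candidate (x ⁻¹) y → Candidate x y
      Candidate-⁻¹⁻ = Candidate-resp (∼-reflexive (⁻¹-involutive _)) ∘ Candidate-⁻¹

      -- the first candidate of the enumeration (the default is never reached); it depends only on
      -- the pair of cosets {xH, x⁻¹H}, and orient then picks the element of it or its inverse in xH
      choice : Carrier → Carrier
      choice x = element (fromMaybe (index ε) (first (λ i → does (candidate? x (element i)))))

      choice-candidate : ∀ x → Candidate x (choice x)
      choice-candidate x with candidate-exists x
      ... | y , cy with first-complete (λ i → does (candidate? x (element i)))
                                       (dec-true (candidate? x _) (Candidate-≈ (sym (element-index y)) cy))
      ...   | j , first≡j , holds rewrite first≡j = does⇒ (candidate? x _) holds

      choice-cong : ∀ {x x′} → (∀ {y} → Candidate x y → Candidate x′ y) → (∀ {y} → Candidate x′ y → Candidate x y) →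
                    choice x ≡ choice x′
      choice-cong to from =
        ≡.cong (element ∘ fromMaybe (index ε)) (first-cong λ i → does-⇔ (mk⇔ to from) (candidate? _ _) (candidate? _ _))

      orient : Carrier → Carrier → Carrier
      orient x y = if does (y ∼? x) then y else y ⁻¹

      orient-∼ : ∀ {x y} → Candidate x y → orient x y ∼ x
      orient-∼ {x} {y} (y∼ , _) with y ∼? x
      ... | yes y∼x = y∼x
      ... | no y≁x  = ∼-trans (∼-⁻¹ y∼x⁻¹) (∼-reflexive (⁻¹-involutive x))
        where y∼x⁻¹ = Data.Sum.[ ⊥-elim ∘ y≁x , id ] y∼

      orient-cong : ∀ {x x′} y → x ∼ x′ → orient x y ≡ orient x′ y
      orient-cong y x∼x′ = ≡.cong (if_then y else y ⁻¹)
        (does-⇔ (mk⇔ (λ y∼x → ∼-trans y∼x x∼x′) (λ y∼x′ → ∼-trans y∼x′ (∼-sym x∼x′))) (y ∼? _) (y ∼? _))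

      orient-⁻¹ : ∀ {x y} → Candidate x y → orient (x ⁻¹) y ≈ orient x y ⁻¹
      orient-⁻¹ {x} {y} (y∼ , y²) with y ∼? x ⁻¹ | y ∼? x
      ... | yes y∼x⁻¹ | yes y∼x = inverseʳ-unique y y (y² (∼-∈ (∼-sym (∼-∙ y∼x⁻¹ y∼x)) x⁻¹∙x∈H))
        where x⁻¹∙x∈H = ∈-resp H (sym (inverseˡ x)) ε∈
      ... | yes _     | no _    = sym (⁻¹-involutive y)
      ... | no _      | yes _   = refl
      ... | no y≁x⁻¹  | no y≁x  = ⊥-elim (Data.Sum.[ y≁x , y≁x⁻¹ ] y∼)

      transversal : SymmetricTransversal
      transversal = record
        { rep      = rep
        ; rep-∼    = λ x → orient-∼ (choice-candidate x)
        ; rep-cong = λ {x} {x′} x∼x′ → reflexive (≡.trans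
            (≡.cong (orient x) (choice-cong (Candidate-resp x∼x′) (Candidate-resp (∼-sym x∼x′))))
            (orient-cong (choice x′) x∼x′))
        ; rep-⁻¹   = λ x → trans
            (reflexive (≡.cong (orient (x ⁻¹)) (choice-cong Candidate-⁻¹⁻ Candidate-⁻¹)))
            (orient-⁻¹ (choice-candidate x))
        }
        where
        rep : Carrier → Carrier
        rep x = orient x (choice x)

    involutionCondition⇒perfectCode : ∀ H → IsSubgroup G H → InvolutionCondition H → IsPerfectCodeOf G H
    involutionCondition⇒perfectCode H H-sub condition =
      Subgroup.transversal⇒perfectCode H H-sub _≈?_ (Transversal.transversal H H-sub condition)

    annihilatedBy : ℕ → Subset G
    annihilatedBy k = decSubset (λ y → k · y ≈ ε) (λ y → k · y ≈? ε) (·≈ε-resp k)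

    annihilatedBy-subgroup : ∀ k → IsSubgroup G (annihilatedBy k)
    annihilatedBy-subgroup k = ⁺ (·-ε k) , ∙-closed , ⁻¹-closed
      where
      ⁺ : ∀ {y} → k · y ≈ ε → y ∈ annihilatedBy k
      ⁺ = dec-true (k · _ ≈? ε)
      ⁻ : ∀ {y} → y ∈ annihilatedBy k → k · y ≈ ε
      ⁻ = does⇒ (k · _ ≈? ε)
      ∙-closed : ∀ x y → x ∈ annihilatedBy k → y ∈ annihilatedBy k → x ∙ y ∈ annihilatedBy k
      ∙-closed x y x∈ y∈ = ⁺ (trans (×-distrib-+ x y k) (trans (∙-cong (⁻ x∈) (⁻ y∈)) (identityʳ ε)))
      ⁻¹-closed : ∀ x → x ∈ annihilatedBy k → x ⁻¹ ∈ annihilatedBy k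
      ⁻¹-closed x x∈ = ⁺ (trans (·-⁻¹ k x) (trans (⁻¹-cong (⁻ x∈)) ε⁻¹≈ε))

    noPerfectCode⇒2-group : NotSimple G → NoPerfectCodeSubgroup → ∃ λ k → ∀ g → (2 ^ k) · g ≈ ε
    noPerfectCode⇒2-group (H , H-sub , _ , H-nontrivial , H-proper) noPerfectCode with 2-adic (n !) {{n ℕ.!≢0}}
    ... | e , r , n!≡2^e*q = e , λ g → odd-trivial ((2 ^ e) · g) (begin
      q · (2 ^ e) · g  ≈⟨ ×-assocˡ g q (2 ^ e) ⟩
      (q * 2 ^ e) · g  ≈⟨ reflexive (≡.cong (_· g) (≡.trans (ℕ.*-comm q (2 ^ e)) (≡.sym n!≡2^e*q))) ⟩
      (n !) · g        ≈⟨ n!·x≈ε g ⟩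
      ε                ∎)
      where
      -- n! = 2^e q with q odd, so O consists of the elements of odd order
      q = suc (2 * r)
      O = annihilatedBy q
      O-sub = annihilatedBy-subgroup q

      O-perfect : IsPerfectCodeOf G O
      O-perfect = involutionCondition⇒perfectCode O O-sub
        (oddExponent⇒involutionCondition O r O-sub λ h → does⇒ (q · h ≈? ε))

      odd-trivial : ∀ y → q · y ≈ ε → y ≈ ε
      odd-trivial y qy≈ε with y ≈? ε
      ... | yes y≈ε = y≈ε
      ... | no y≉ε with ∀⊎∃¬ (λ z → q · z ≈? ε) (·≈ε-resp q)
      ...   | inj₂ (z , qz≉ε) = ⊥-elim (noPerfectCode O O-sub (y , dec-true (q · y ≈? ε) qy≈ε , y≉ε)
                                                       (z , qz≉ε ∘ does⇒ (q · z ≈? ε)) O-perfect)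
      ...   | inj₁ O≡G = ⊥-elim (noPerfectCode H H-sub H-nontrivial H-proper
                 (involutionCondition⇒perfectCode H H-sub (oddExponent⇒involutionCondition H r H-sub λ h _ → O≡G h)))

    exactExponent : ∀ k → (∀ g → (2 ^ k) · g ≈ ε) →
                    (∀ g → g ≈ ε) ⊎ ∃ λ m → (∀ g → (2 ^ suc m) · g ≈ ε) × ∃ λ a → ¬ (2 ^ m) · a ≈ ε
    exactExponent zero    exponent = inj₁ λ g → trans (sym (identityʳ g)) (exponent g)
    exactExponent (suc k) exponent with ∀⊎∃¬ (λ g → (2 ^ k) · g ≈? ε) (·≈ε-resp (2 ^ k))
    ... | inj₁ smaller = exactExponent k smaller
    ... | inj₂ (a , 2^ka≉ε) = inj₂ (k , exponent , a , 2^ka≉ε)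

    module CyclicSubgroup (m : ℕ) (a : Carrier) (2^[1+m]a≈ε : (2 ^ suc m) · a ≈ ε) (2^ma≉ε : ¬ (2 ^ m) · a ≈ ε)
                          (exponent : ∀ g → (2 ^ suc m) · g ≈ ε) where
      open CyclicTwoPower m a 2^[1+m]a≈ε 2^ma≉ε

      Multiple : Carrier → Set
      Multiple y = ∃ λ (j : Fin N) → toℕ j · a ≈ y

      multiple? : ∀ y → Dec (Multiple y)
      multiple? y = Fin.any? λ j → toℕ j · a ≈? y

      ⟨a⟩ : Subset G
      ⟨a⟩ = decSubset Multiple multiple? λ x≈y (j , ja≈x) → j , trans ja≈x x≈y

      ∈⟨a⟩⁺ : ∀ j {y} → j · a ≈ y → y ∈ ⟨a⟩
      ∈⟨a⟩⁺ j ja≈y = dec-true (multiple? _)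
        (j mod N , trans (reflexive (≡.cong (_· a) (Fin.toℕ-fromℕ< (m%n<n j N)))) (trans (sym (·-mod j)) ja≈y))

      ∈⟨a⟩⁻ : ∀ {y} → y ∈ ⟨a⟩ → ∃ λ j → j · a ≈ y
      ∈⟨a⟩⁻ y∈ with does⇒ (multiple? _) y∈
      ... | j , ja≈y = toℕ j , ja≈y

      ⟨a⟩-subgroup : IsSubgroup G ⟨a⟩
      ⟨a⟩-subgroup = ∈⟨a⟩⁺ 0 refl , ∙-closed , ⁻¹-closed
        where
        ∙-closed : ∀ x y → x ∈ ⟨a⟩ → y ∈ ⟨a⟩ → x ∙ y ∈ ⟨a⟩
        ∙-closed x y x∈ y∈ with ∈⟨a⟩⁻ x∈ | ∈⟨a⟩⁻ y∈
        ... | i , ia≈x | j , ja≈y = ∈⟨a⟩⁺ (i + j) (trans (×-homo-+ a i j) (∙-cong ia≈x ja≈y))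
        ⁻¹-closed : ∀ x → x ∈ ⟨a⟩ → x ⁻¹ ∈ ⟨a⟩
        ⁻¹-closed x x∈ with ∈⟨a⟩⁻ x∈
        ... | i , ia≈x = ∈⟨a⟩⁺ ((N ∸ 1) * i) (begin
          ((N ∸ 1) * i) · a    ≈⟨ ×-assocˡ a (N ∸ 1) i ⟨
          (N ∸ 1) · i · a      ≈⟨ ×-congʳ (N ∸ 1) ia≈x ⟩
          (N ∸ 1) · x          ≈⟨ inverseʳ-unique x _ (trans (reflexive (≡.cong (_· x) (ℕ.suc-pred N))) (exponent x)) ⟩
          x ⁻¹                 ∎)

      ⟨a⟩-nontrivial : Nontrivial G ⟨a⟩
      ⟨a⟩-nontrivial = a , ∈⟨a⟩⁺ 1 (identityʳ a) , λ a≈ε → 2^ma≉ε (trans (×-congʳ (2 ^ m) a≈ε) (·-ε (2 ^ m)))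

      -- as a has maximal order, g² = k·a forces k to be even; then g (k/2 · a)⁻¹ has order at most 2
      ⟨a⟩-involutionCondition : InvolutionCondition ⟨a⟩
      ⟨a⟩-involutionCondition g g²∈ with ∈⟨a⟩⁻ g²∈
      ... | k , ka≈g² with *-cancelˡ-∣ (2 ^ m) {{ℕ.m^n≢0 2 m}}
                             (≡.subst (_∣ 2 ^ m * k) (ℕ.*-comm 2 (2 ^ m)) (order-divides _ 2^m*k·a≈ε))
        where
        2^m*k·a≈ε : (2 ^ m * k) · a ≈ ε
        2^m*k·a≈ε = begin
          (2 ^ m * k) · a      ≈⟨ ×-assocˡ a (2 ^ m) k ⟨
          (2 ^ m) · k · a      ≈⟨ ×-congʳ (2 ^ m) (trans ka≈g² (sym (2·x≈x∙x g))) ⟩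
          (2 ^ m) · 2 · g      ≈⟨ ×-assocˡ g (2 ^ m) 2 ⟩
          (2 ^ m * 2) · g      ≈⟨ reflexive (≡.cong (_· g) (ℕ.*-comm (2 ^ m) 2)) ⟩
          N · g                ≈⟨ exponent g ⟩
          ε                    ∎
      ... | divides q k≡q*2 = (q · a) ⁻¹ , proj₂ (proj₂ ⟨a⟩-subgroup) _ (∈⟨a⟩⁺ q refl) , (begin
          (g ∙ (q · a) ⁻¹) ∙ (g ∙ (q · a) ⁻¹)   ≈⟨ interchange g _ g _ ⟩
          (g ∙ g) ∙ ((q · a) ⁻¹ ∙ (q · a) ⁻¹)   ≈⟨ ∙-congˡ (⁻¹-∙-comm _ _) ⟩
          (g ∙ g) ∙ (q · a ∙ q · a) ⁻¹          ≈⟨ ∙-congˡ (⁻¹-cong (×-homo-+ a q q)) ⟨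
          (g ∙ g) ∙ ((q + q) · a) ⁻¹            ≈⟨ ∙-congˡ (⁻¹-cong (reflexive (≡.cong (_· a) q+q≡k))) ⟩
          (g ∙ g) ∙ (k · a) ⁻¹                  ≈⟨ ∙-congˡ (⁻¹-cong ka≈g²) ⟩
          (g ∙ g) ∙ (g ∙ g) ⁻¹                  ≈⟨ inverseʳ _ ⟩
          ε                                     ∎)
        where
        q+q≡k : q + q ≡ k
        q+q≡k = ≡.sym (≡.trans k≡q*2 (≡.trans (ℕ.*-comm q 2) (≡.cong (q +_) (ℕ.+-identityʳ q))))

      ⟨a⟩-perfectCode : IsPerfectCodeOf G ⟨a⟩
      ⟨a⟩-perfectCode = involutionCondition⇒perfectCode ⟨a⟩ ⟨a⟩-subgroup ⟨a⟩-involutionCondition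

      noPerfectCode⇒⟨a⟩≡G : NoPerfectCodeSubgroup → ∀ y → y ∈ ⟨a⟩
      noPerfectCode⇒⟨a⟩≡G noPerfectCode y with y ∈? ⟨a⟩
      ... | yes y∈⟨a⟩ = y∈⟨a⟩
      ... | no y∉⟨a⟩  = ⊥-elim (noPerfectCode ⟨a⟩ ⟨a⟩-subgroup ⟨a⟩-nontrivial (y , y∉⟨a⟩) ⟨a⟩-perfectCode)

      involution-in-⟨a⟩ : ∀ y → y ∈ ⟨a⟩ → y ∙ y ≈ ε → y ≈ ε ⊎ y ≈ t
      involution-in-⟨a⟩ y y∈⟨a⟩ y²≈ε with ∈⟨a⟩⁻ y∈⟨a⟩
      ... | j , ja≈y = Data.Sum.map (trans (sym ja≈y)) (trans (sym ja≈y))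
                                     (involution-ε⊎t j (trans (∙-cong ja≈y ja≈y) y²≈ε))

      ⟨a⟩≡G⇒isoToZ : (∀ y → y ∈ ⟨a⟩) → IsoToZ G N
      ⟨a⟩≡G⇒isoToZ ⟨a⟩≡G = φ , hom
        where
        to : Fin N → Carrier
        to j = toℕ j · a

        multipleOf : ∀ i → Multiple (element i)
        multipleOf i = does⇒ (multiple? _) (⟨a⟩≡G (element i))

        from : Carrier → Fin N
        from y = proj₁ (multipleOf (index y))

        to-from : ∀ y → to (from y) ≈ y
        to-from y = trans (proj₂ (multipleOf (index y))) (element-index y)

        φ : Inverse (≡.setoid (Fin N)) setoid
        φ = record
          { to        = to
          ; from      = from
          ; to-cong   = reflexive ∘ ≡.cong to
          ; from-cong = ≡.cong (proj₁ ∘ multipleOf) ∘ Inverse.to-cong (proj₂ fin)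
          ; inverse   = (λ {y} j≡from-y → trans (reflexive (≡.cong to j≡from-y)) (to-from y))
                      , (λ {j} {y} y≈to-j → Fin.toℕ-injective
                           (·-injective (Fin.toℕ<n (from y)) (Fin.toℕ<n j) (trans (to-from y) y≈to-j)))
          }

        hom : ∀ i j → to (addMod N i j) ≈ to i ∙ to j
        hom i j = begin
          toℕ (addMod N i j) · a          ≈⟨ reflexive (≡.cong (_· a) (Fin.toℕ-fromℕ< (m%n<n (toℕ i + toℕ j) N))) ⟩
          ((toℕ i + toℕ j) % N) · a       ≈⟨ ·-mod _ ⟨
          (toℕ i + toℕ j) · a             ≈⟨ ×-homo-+ a (toℕ i) (toℕ j) ⟩
          toℕ i · a ∙ toℕ j · a           ∎

    noPerfectCodeSubgroup⇒cyclic2Power : NotSimple G → NoPerfectCodeSubgroup → IsCyclic2Power G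
    noPerfectCodeSubgroup⇒cyclic2Power notSimple noPerfectCode
      with uncurry exactExponent (noPerfectCode⇒2-group notSimple noPerfectCode)
    ... | inj₁ trivial = ⊥-elim (atMostTwo⇒¬NotSimple ε (inj₁ ∘ trivial) notSimple)
    ... | inj₂ (zero , exponent , a , a≉ε) = ⊥-elim (atMostTwo⇒¬NotSimple a ε-or-a notSimple)
      where
      open CyclicSubgroup 0 a (exponent a) a≉ε exponent
      ε-or-a : ∀ y → y ≈ ε ⊎ y ≈ a
      ε-or-a y = Data.Sum.map₂ (λ y≈t → trans y≈t (identityʳ a))
        (involution-in-⟨a⟩ y (noPerfectCode⇒⟨a⟩≡G noPerfectCode y) (trans (sym (2·x≈x∙x y)) (exponent y)))
    ... | inj₂ (suc m , exponent , a , 2^[1+m]a≉ε) =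
      suc (suc m) , s≤s (s≤s ℕ.z≤n) , ⟨a⟩≡G⇒isoToZ (noPerfectCode⇒⟨a⟩≡G noPerfectCode)
      where open CyclicSubgroup (suc m) a (exponent a) 2^[1+m]a≉ε exponent

theorem1p6 : (G : AbelianGroup 0ℓ 0ℓ) → IsFinite G → NotSimple G →
    ((∀ H → IsSubgroup G H → Nontrivial G H → Proper G H → ¬ IsPerfectCodeOf G H)
      ⇔ IsCyclic2Power G)
theorem1p6 G fin notSimple =
  mk⇔ (Finite.noPerfectCodeSubgroup⇒cyclic2Power G fin notSimple) (cyclic2Power⇒noPerfectCodeSubgroup G)
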